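{- Let $G$ be a simple graph of order $n\ge2$ and let $t\ge 3$. Then the set $\big\{\{i,j\}_t : ij\in E(G)\big\}$ of all contracted vertices at step $t$ is an independent set in $S[G,t]$.
   Context: Let $G$ be a simple graph with vertex set $V=\{1,\dots,n\}$, $n\ge 2$. For $t\ge 1$, the generalized Sierpiński graph $S(G,t)$ has vertex set $V^t$ (words $u_1u_2\cdots u_t$ over $V$), and two words ${\bf u}=u_1\cdots u_t$, ${\bf v}=v_1\cdots v_t$ are adjacent iff there is $i\in\{1,\dots,t\}$ with $u_j=v_j$ for $j<i$, $u_i\neq v_i$ and $u_iv_i\in E(G)$, and $u_j=v_i$, $v_j=u_i$ for all $j>i$. An edge of this kind with $i<t$ is called a linking edge; it joins $w\,ab\cdots b$ and $w\,ba\cdots a$ where $w$ is a word of length $r=i-1\le t-2$ and $ab\in E(G)$, and it is said to appear at step $t-r$. The generalized Sierpiński gasket $S[G,t]$ is the graph obtained from $S(G,t)$ by contracting all linking edges. For $ij\in E(G)$, $\{i,j\}_t$ denotes the vertex of $S[G,t]$ obtained by contracting the linking edge between $ij\cdots j$ and $ji\cdots i$ (these are the contracted vertices at step $t$). -}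

module Defs where

open import Level using (0ℓ)
open import Data.Nat using (ℕ; zero; suc; _<_)
open import Data.Fin using (Fin; zero; suc; toℕ)
open import Data.Product using (Σ; ∃; _×_)
open import Relation.Binary.PropositionalEquality using (_≡_; _≢_)
open import Relation.Binary.Construct.Closure.Equivalence using (EqClosure)
open import Relation.Nullary using (¬_)

record SimpleGraph (n : ℕ) : Set₁ where
  field
    E     : Fin n → Fin n → Set
    sym   : ∀ {a b} → E a b → E b a
    irrefl : ∀ {a} → ¬ E a a
open SimpleGraph public

Word : ℕ → ℕ → Set
Word n t = Fin t → Fin n

module _ {n : ℕ} (G : SimpleGraph n) {t : ℕ} where

  -- u ~ v in S(G,t) witnessed at position i (0-based; paper's i is toℕ i + 1).
  AdjAt : Word n t → Word n t → Fin t → Set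
  AdjAt u v i =
      (∀ j → toℕ j < toℕ i → u j ≡ v j)
    × u i ≢ v i
    × E G (u i) (v i)
    × (∀ j → toℕ i < toℕ j → (u j ≡ v i) × (v j ≡ u i))

  SAdj : Word n t → Word n t → Set
  SAdj u v = ∃ λ i → AdjAt u v i

  -- linking edges: those with paper index i < t
  Linking : Word n t → Word n t → Set
  Linking u v = ∃ λ i → (suc (toℕ i) < t) × AdjAt u v i

  -- two words represent the same vertex of S[G,t] iff they are identified
  -- by the equivalence relation generated by the linking edges
  SameGasketVertex : Word n t → Word n t → Set
  SameGasketVertex = EqClosure Linking

  GasketAdj : Word n t → Word n t → Set
  GasketAdj x y =
      ¬ SameGasketVertex x y
    × ∃ λ u → ∃ λ v → SameGasketVertex u x × SameGasketVertex v y × SAdj u v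

abWord : ∀ {n} → Fin n → Fin n → (t : ℕ) → Word n t
abWord a b (suc t) zero    = a
abWord a b (suc t) (suc k) = b

{-# OPTIONS --safe #-}
module Submission where

-- A word of the form a b b ⋯ b has a constant tail, and so does every word
-- joined to it by a linking edge: an edge at a position i that is neither the
-- first nor the last would need u i ≢ u (i+1).  Hence the gasket vertex
-- {i,j}_t consists of words with constant tail only.  For t ≥ 3 an edge of
-- S(G,t) between two such words cannot sit at position 1 (the tail of u would
-- change after it) nor further right (the words agree at position 1, hence on
-- their whole tails), so it is a linking edge and its ends are the same
-- gasket vertex.

open import Defs hiding (sym)
open import Data.Nat using (ℕ; suc; _≤_; _<_; z≤n; s≤s)
open import Data.Nat.Properties using (≤-reflexive; <-trans)
open import Data.Fin using (Fin; zero; suc; toℕ; fromℕ<)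
open import Data.Fin.Properties using (toℕ-fromℕ<)
open import Data.Empty using (⊥; ⊥-elim)
open import Data.Product using (_,_; proj₁; proj₂)
open import Function.Bundles using (_⇔_; mk⇔; module Equivalence)
open import Function.Properties.Equivalence using (⇔-isEquivalence)
open import Relation.Nullary using (¬_)
open import Relation.Binary.PropositionalEquality
open import Relation.Binary.Construct.Closure.ReflexiveTransitive using (_◅◅_; return)
open import Relation.Binary.Construct.Closure.Symmetric using (fwd)
open import Relation.Binary.Construct.Closure.Equivalence using (symmetric; gfold)

record ConstantTail {n m : ℕ} (u : Word n (suc m)) : Set where
  constructor _,_
  field
    letter : Fin n
    tail   : ∀ k → u (suc k) ≡ letter
open ConstantTail

abWord-constantTail : ∀ {n m} (a b : Fin n) → ConstantTail (abWord a b (suc m))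
abWord-constantTail a b = b , λ _ → refl

constantTail-≡ : ∀ {n m} {u : Word n (suc m)} (c : ConstantTail u) →
  ∀ j → 0 < toℕ j → u j ≡ letter c
constantTail-≡ c (suc k) _ = tail c k

module _ {n : ℕ} (G : SimpleGraph n) where

  adjAt-sym : ∀ {t} {u v : Word n t} {i} → AdjAt G u v i → AdjAt G v u i
  adjAt-sym (prefix , u≢v , e , suffix) =
      (λ j j<i → sym (prefix j j<i))
    , (λ v≡u → u≢v (sym v≡u))
    , SimpleGraph.sym G e
    , (λ j i<j → proj₂ (suffix j i<j) , proj₁ (suffix j i<j))

  linking-sym : ∀ {t} {u v : Word n t} → Linking G u v → Linking G v u
  linking-sym (i , nonLast , adj) = i , nonLast , adjAt-sym adj

  adjAt-later≢ : ∀ {t} {u v : Word n t} {i j} → AdjAt G u v i →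
    toℕ i < toℕ j → u j ≢ u i
  adjAt-later≢ (_ , u≢v , _ , suffix) i<j uj≡ui =
    u≢v (trans (sym uj≡ui) (proj₁ (suffix _ i<j)))

  constantTail-¬adjAt-inner : ∀ {m} {u v : Word n (suc m)} {i j} →
    ConstantTail u → AdjAt G u v i → 0 < toℕ i → toℕ i < toℕ j → ⊥
  constantTail-¬adjAt-inner c adj 0<i i<j =
    adjAt-later≢ adj i<j
      (trans (constantTail-≡ c _ (<-trans 0<i i<j)) (sym (constantTail-≡ c _ 0<i)))

  linking-constantTail : ∀ {m} {u v : Word n (suc m)} →
    Linking G u v → ConstantTail u → ConstantTail v
  linking-constantTail {u = u} (zero , _ , (_ , _ , _ , suffix)) _ =
    u zero , λ k → proj₂ (suffix (suc k) (s≤s z≤n))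
  linking-constantTail (suc i , nonLast , adj) c =
    ⊥-elim (constantTail-¬adjAt-inner c adj (s≤s z≤n)
      (≤-reflexive (sym (toℕ-fromℕ< nonLast))))

  sameGasketVertex-constantTail : ∀ {m} {u v : Word n (suc m)} →
    SameGasketVertex G u v → ConstantTail u ⇔ ConstantTail v
  sameGasketVertex-constantTail = gfold ⇔-isEquivalence ConstantTail
    (λ l → mk⇔ (linking-constantTail l) (linking-constantTail (linking-sym l)))

  -- Needs length ≥ 3: for t = 2 the words ab and ac are adjacent at position 1.
  constantTail-adjAt⇒linking : ∀ {m} {u v : Word n (suc (suc (suc m)))} →
    ConstantTail u → ConstantTail v → SAdj G u v → Linking G u v
  constantTail-adjAt⇒linking _ _ (zero , adj) = zero , s≤s (s≤s z≤n) , adj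
  constantTail-adjAt⇒linking cu _ (suc zero , adj) =
    ⊥-elim (constantTail-¬adjAt-inner {j = suc (suc zero)} cu adj (s≤s z≤n) (s≤s (s≤s z≤n)))
  constantTail-adjAt⇒linking {u = u} {v} cu cv (suc (suc i) , prefix , u≢v , _) =
    ⊥-elim (u≢v (begin
      u (suc (suc i))  ≡⟨ constantTail-≡ cu _ (s≤s z≤n) ⟩
      letter cu        ≡⟨ constantTail-≡ cu (suc zero) (s≤s z≤n) ⟨
      u (suc zero)     ≡⟨ prefix (suc zero) (s≤s (s≤s z≤n)) ⟩
      v (suc zero)     ≡⟨ constantTail-≡ cv (suc zero) (s≤s z≤n) ⟩
      letter cv        ≡⟨ constantTail-≡ cv _ (s≤s z≤n) ⟨
      v (suc (suc i))  ∎))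
    where open ≡-Reasoning

mainTheorem11 : (n : ℕ) → 2 ≤ n → (G : SimpleGraph n) → (t : ℕ) → 3 ≤ t →
    ∀ i j k l → E G i j → E G k l →
    ¬ GasketAdj G (abWord i j t) (abWord k l t)
mainTheorem11 n _ G (suc (suc (suc m))) (s≤s (s≤s (s≤s _))) i j k l _ _
  (distinct , u , v , u≈ij , v≈kl , adj) =
  distinct (symmetric (Linking G) u≈ij ◅◅ return (fwd link) ◅◅ v≈kl)
  where
  constantTail : ∀ {w a b} → SameGasketVertex G w (abWord a b _) → ConstantTail w
  constantTail w≈ab =
    Equivalence.from (sameGasketVertex-constantTail G w≈ab) (abWord-constantTail _ _)
  link : Linking G u v
  link = constantTail-adjAt⇒linking G (constantTail u≈ij) (constantTail v≈kl) adj
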